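{- Let $G$ be a split graph. Then $\operatorname{bp}(G)\geq \operatorname{mc}(G^c)-2$.
   Context: A finite simple graph $G=(V,E)$ is a split graph if $V$ can be partitioned into $V_1,V_2$ with $G(V_1)$ a clique and $V_2$ an independent set. $\operatorname{mc}(H)$ is the number of maximal cliques of $H$. A biclique $\{L,R\}$ is the complete bipartite graph with disjoint vertex sets $L,R$ and edge set $\{uv:u\in L,v\in R\}$; a biclique partition of $G$ is a collection of biclique subgraphs of $G$ such that every edge lies in exactly one of them; $\operatorname{bp}(G)$ is the minimum size of a biclique partition. -}

module Defs where

open import Data.Nat using (ℕ)
open import Data.Fin using (Fin)
open import Data.Fin.Subset using (Subset; _∈_; _∉_; _⊆_; ∁)
open import Data.Product using (Σ; _×_; ∃; ∃-syntax)
open import Data.Sum using (_⊎_)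
open import Data.List using (List; length)
open import Data.List.Relation.Unary.Unique.Propositional using (Unique)
import Data.List.Membership.Propositional as LM
open import Relation.Nullary using (¬_; Dec)
open import Relation.Binary.PropositionalEquality using (_≡_; _≢_)

record Graph (n : ℕ) : Set₁ where
  field
    E      : Fin n → Fin n → Set
    E-dec  : ∀ u v → Dec (E u v)
    E-sym  : ∀ {u v} → E u v → E v u
    E-irr  : ∀ {u} → ¬ E u u
open Graph public

complement : ∀ {n} → Graph n → Graph n
complement G = record
  { E     = λ u v → (u ≢ v) × ¬ E G u v
  ; E-dec = dec
  ; E-sym = λ { (u≢v , ¬e) → (λ p → u≢v (sym' p)) , (λ e → ¬e (E-sym G e)) }
  ; E-irr = λ { (u≢u , _) → u≢u _≡_.refl }
  }
  where
  open import Relation.Nullary using (yes; no)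
  open import Data.Product using (_,_)
  open import Data.Fin using (_≟_)
  sym' : ∀ {a b : Fin _} → a ≡ b → b ≡ a
  sym' _≡_.refl = _≡_.refl
  dec : ∀ u v → Dec ((u ≢ v) × ¬ E G u v)
  dec u v with u ≟ v | E-dec G u v
  ... | yes p | _     = no λ { (q , _) → q p }
  ... | no q  | yes e = no λ { (_ , r) → r e }
  ... | no q  | no r  = yes (q , r)

IsClique : ∀ {n} → Graph n → Subset n → Set
IsClique G K = ∀ {u v} → u ∈ K → v ∈ K → u ≢ v → E G u v

IsIndependent : ∀ {n} → Graph n → Subset n → Set
IsIndependent G I = ∀ {u v} → u ∈ I → v ∈ I → ¬ E G u v

IsMaximalClique : ∀ {n} → Graph n → Subset n → Set
IsMaximalClique G K = IsClique G K × (∀ K′ → K ⊆ K′ → IsClique G K′ → K′ ⊆ K)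

IsSplit : ∀ {n} → Graph n → Set
IsSplit G = ∃[ V₁ ] (IsClique G V₁ × IsIndependent G (∁ V₁))

-- mc(H) = m : L is a duplicate-free list of exactly the maximal cliques of H
-- and m is its length.
record MaxCliqueEnum {n} (H : Graph n) : Set where
  field
    cliques  : List (Subset n)
    unique   : Unique cliques
    complete : ∀ K → (K LM.∈ cliques → IsMaximalClique H K)
                   × (IsMaximalClique H K → K LM.∈ cliques)

mc : ∀ {n} {H : Graph n} → MaxCliqueEnum H → ℕ
mc L = length (MaxCliqueEnum.cliques L)

-- A biclique {L,R}: disjoint vertex sets L and R, edges all uv with u∈L, v∈R.
record Biclique (n : ℕ) : Set where
  constructor biclique
  field
    left right : Subset n
    disjoint   : ∀ {v} → v ∈ left → v ∉ right

BicliqueIn : ∀ {n} → Graph n → Biclique n → Set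
BicliqueIn G B = ∀ {u v} → u ∈ Biclique.left B → v ∈ Biclique.right B → E G u v

EdgeOf : ∀ {n} → Biclique n → Fin n → Fin n → Set
EdgeOf B u v = (u ∈ Biclique.left B × v ∈ Biclique.right B)
             ⊎ (v ∈ Biclique.left B × u ∈ Biclique.right B)

record BicliquePartition {n} (G : Graph n) (k : ℕ) : Set where
  field
    part      : Fin k → Biclique n
    subgraph  : ∀ i → BicliqueIn G (part i)
    covers    : ∀ {u v} → E G u v → ∃[ i ] EdgeOf (part i) u v
    exactly   : ∀ {u v} → E G u v → ∀ i j →
                EdgeOf (part i) u v → EdgeOf (part j) u v → i ≡ j

-- Let C be the clique and ∁ C the independent set of the split graph G. A clique
-- of Gᶜ contains at most one vertex of C, and if two maximal cliques of Gᶜ have the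
-- same trace on C (one common vertex c, or nothing) then their union is again a
-- clique of Gᶜ, since its other vertices lie in ∁ C and are not G-adjacent to c;
-- so the two cliques coincide. Hence all maximal cliques of Gᶜ but at most one meet
-- C, in pairwise distinct vertices, which span a clique K_p of G with
-- mc(Gᶜ) ≤ p + 1. A biclique partition of G restricts to one of K_p, and
-- p ≤ bp(G) + 1 by Graham–Pollak: with aᵢ, bᵢ the indicator vectors of the sides
-- of the bicliques, ∑ᵢ (aᵢbᵢᵀ + bᵢaᵢᵀ) = J − I, and if p > bp(G) + 1 some y ≠ 0
-- has ∑ y = 0 and aᵢ·y = 0 for all i, whence −∑ⱼ yⱼ² = yᵀ(J − I)y = ∑ᵢ 2(aᵢ·y)(bᵢ·y) = 0.

module Submission where

open import Defs
open import Data.Nat as ℕ using (ℕ; zero; suc; _≤_; _<_; z≤n; s≤s)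
import Data.Nat.Properties as ℕ
open import Data.Fin using (Fin; zero; suc; _≟_)
import Data.Fin.Properties as Fin
open import Data.Fin.Subset using (Subset; _∈_; _∪_; ∁)
open import Data.Fin.Subset.Properties using (_∈?_; x∉p⇒x∈∁p; x∈p∪q⁻; p⊆p∪q; q⊆p∪q; ⊆-antisym)
open import Data.Maybe using (Maybe; just; nothing)
open import Data.List using (List; []; _∷_; length; lookup; mapMaybe)
open import Data.List.Membership.Propositional using () renaming (_∈_ to _∈ₗ_)
open import Data.List.Membership.Propositional.Properties using (∈-lookup)
open import Data.List.Relation.Unary.All as All using (All; _∷_)
open import Data.List.Relation.Unary.Any using (here; there)
open import Data.List.Relation.Unary.Unique.Propositional using (Unique; []; _∷_)
open import Data.Product using (_×_; _,_; ∃-syntax; proj₁; proj₂)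
open import Data.Sum using (_⊎_; inj₁; inj₂)
open import Function using (_∘_)
open import Relation.Nullary using (¬_; Dec; yes; no; contradiction)
open import Relation.Nullary.Decidable using (_×-dec_)
open import Relation.Binary.PropositionalEquality

module GrahamPollak where

  open import Data.Integer as ℤ using (ℤ; 0ℤ; 1ℤ; _+_; _*_; -_; _-_)
  import Data.Integer.Properties as ℤ
  open import Data.Integer.Tactic.RingSolver using (solve-∀)
  open import Algebra.Properties.Semiring.Sum ℤ.+-*-semiring
    using (sum; sum-syntax; sum-cong-≗; sum-replicate-zero; ∑-distrib-+; ∑-comm; *-distribˡ-sum; *-distribʳ-sum)
  open import Data.List using (map; tabulate)
  open import Data.List.Properties using (length-map; length-removeAt′; length-tabulate)
  open import Data.List.Relation.Unary.All using (all?)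
  import Data.List.Relation.Unary.All.Properties as All
  import Data.List.Relation.Unary.Any as Any
  open import Data.List.Relation.Unary.Any.Properties using (lookup-result)
  open import Data.Sum using ([_,_]′)
  open import Function using (id; flip)
  open import Relation.Nullary.Decidable using (_⊎-dec_)
  import Algebra.Properties.Semiring.Sum ℕ.+-*-semiring as ℕΣ

  δ : ∀ {p} → Fin p → Fin p → ℤ
  δ zero    zero    = 1ℤ
  δ zero    (suc _) = 0ℤ
  δ (suc _) zero    = 0ℤ
  δ (suc i) (suc j) = δ i j

  δ-refl : ∀ {p} (i : Fin p) → δ i i ≡ 1ℤ
  δ-refl zero    = refl
  δ-refl (suc i) = δ-refl i

  δ-≢ : ∀ {p} {i j : Fin p} → i ≢ j → δ i j ≡ 0ℤ
  δ-≢ {i = zero}  {zero}  i≢j = contradiction refl i≢j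
  δ-≢ {i = zero}  {suc _} _   = refl
  δ-≢ {i = suc _} {zero}  _   = refl
  δ-≢ {i = suc i} {suc j} i≢j = δ-≢ (i≢j ∘ cong suc)

  ∑-zero : ∀ {p} {f : Fin p → ℤ} → (∀ j → f j ≡ 0ℤ) → ∑[ j < p ] f j ≡ 0ℤ
  ∑-zero {p} f≡0 = trans (sum-cong-≗ f≡0) (sum-replicate-zero p)

  ∑-δ : ∀ {p} (i : Fin p) (f : Fin p → ℤ) → ∑[ j < p ] (δ i j * f j) ≡ f i
  ∑-δ zero f = begin
    1ℤ * f zero + ∑[ j < _ ] (0ℤ * f (suc j))
      ≡⟨ cong₂ _+_ (ℤ.*-identityˡ (f zero)) (∑-zero (λ j → ℤ.*-zeroˡ (f (suc j)))) ⟩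
    f zero + 0ℤ
      ≡⟨ ℤ.+-identityʳ (f zero) ⟩
    f zero ∎
    where open ≡-Reasoning
  ∑-δ (suc i) f = begin
    0ℤ * f zero + ∑[ j < _ ] (δ i j * f (suc j))
      ≡⟨ cong (_+ ∑[ j < _ ] (δ i j * f (suc j))) (ℤ.*-zeroˡ (f zero)) ⟩
    0ℤ + ∑[ j < _ ] (δ i j * f (suc j))
      ≡⟨ ℤ.+-identityˡ _ ⟩
    ∑[ j < _ ] (δ i j * f (suc j))
      ≡⟨ ∑-δ i (f ∘ suc) ⟩
    f (suc i) ∎
    where open ≡-Reasoning

  dot : ∀ {p} → (Fin p → ℤ) → (Fin p → ℤ) → ℤ
  dot {p} a y = ∑[ j < p ] (a j * y j)

  quad : ∀ {p} → (Fin p → Fin p → ℤ) → (Fin p → ℤ) → ℤ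
  quad {p} M y = ∑[ j < p ] ∑[ j′ < p ] (y j * M j j′ * y j′)

  quad-cong : ∀ {p} {M N : Fin p → Fin p → ℤ} → (∀ j j′ → M j j′ ≡ N j j′) →
              ∀ y → quad M y ≡ quad N y
  quad-cong M≡N y = sum-cong-≗ λ j → sum-cong-≗ λ j′ → cong (λ m → y j * m * y j′) (M≡N j j′)

  quad-+ : ∀ {p} (M N : Fin p → Fin p → ℤ) y →
           quad (λ j j′ → M j j′ + N j j′) y ≡ quad M y + quad N y
  quad-+ {p} M N y =
    trans (sum-cong-≗ λ j → trans (sum-cong-≗ (distrib j)) (∑-distrib-+ (term M j) (term N j)))
          (∑-distrib-+ (λ j → ∑[ j′ < p ] term M j j′) (λ j → ∑[ j′ < p ] term N j j′))
    where
    term : (Fin p → Fin p → ℤ) → Fin p → Fin p → ℤ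
    term M j j′ = y j * M j j′ * y j′
    *-distrib-+-inside : ∀ a m n b → a * (m + n) * b ≡ a * m * b + a * n * b
    *-distrib-+-inside = solve-∀
    distrib : ∀ j j′ → y j * (M j j′ + N j j′) * y j′ ≡ term M j j′ + term N j j′
    distrib j j′ = *-distrib-+-inside (y j) (M j j′) (N j j′) (y j′)

  quad-∑ : ∀ {p k} (M : Fin k → Fin p → Fin p → ℤ) y →
           quad (λ j j′ → ∑[ i < k ] M i j j′) y ≡ ∑[ i < k ] quad (M i) y
  quad-∑ {p} {k} M y = begin
    ∑[ j < p ] ∑[ j′ < p ] (y j * ∑[ i < k ] M i j j′ * y j′)
      ≡⟨ sum-cong-≗ (λ j → sum-cong-≗ λ j′ → pull-in j j′) ⟩
    ∑[ j < p ] ∑[ j′ < p ] ∑[ i < k ] (y j * M i j j′ * y j′)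
      ≡⟨ sum-cong-≗ (λ j → ∑-comm (λ j′ i → y j * M i j j′ * y j′)) ⟩
    ∑[ j < p ] ∑[ i < k ] ∑[ j′ < p ] (y j * M i j j′ * y j′)
      ≡⟨ ∑-comm (λ j i → ∑[ j′ < p ] (y j * M i j j′ * y j′)) ⟩
    ∑[ i < k ] ∑[ j < p ] ∑[ j′ < p ] (y j * M i j j′ * y j′) ∎
    where
    open ≡-Reasoning
    pull-in : ∀ j j′ → y j * ∑[ i < k ] M i j j′ * y j′ ≡ ∑[ i < k ] (y j * M i j j′ * y j′)
    pull-in j j′ = trans (cong (_* y j′) (*-distribˡ-sum (y j) (λ i → M i j j′)))
                         (*-distribʳ-sum (y j′) (λ i → y j * M i j j′))

  quad-outer : ∀ {p} (a b : Fin p → ℤ) y → quad (λ j j′ → a j * b j′) y ≡ dot a y * dot b y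
  quad-outer {p} a b y = begin
    ∑[ j < p ] ∑[ j′ < p ] (y j * (a j * b j′) * y j′)
      ≡⟨ sum-cong-≗ (λ j → sum-cong-≗ λ j′ → regroup (y j) (a j) (b j′) (y j′)) ⟩
    ∑[ j < p ] ∑[ j′ < p ] (a j * y j * (b j′ * y j′))
      ≡⟨ sum-cong-≗ (λ j → *-distribˡ-sum (a j * y j) (λ j′ → b j′ * y j′)) ⟨
    ∑[ j < p ] (a j * y j * dot b y)
      ≡⟨ *-distribʳ-sum (dot b y) (λ j → a j * y j) ⟨
    dot a y * dot b y ∎
    where
    open ≡-Reasoning
    regroup : ∀ y a b y′ → y * (a * b) * y′ ≡ a * y * (b * y′)
    regroup = solve-∀

  quad-δ : ∀ {p} (y : Fin p → ℤ) → quad δ y ≡ ∑[ j < p ] (y j * y j)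
  quad-δ {p} y = sum-cong-≗ λ j →
    trans (sum-cong-≗ λ j′ → regroup (y j) (δ j j′) (y j′)) (∑-δ j (λ j′ → y j * y j′))
    where
    regroup : ∀ y d y′ → y * d * y′ ≡ d * (y * y′)
    regroup = solve-∀

  module Elimination {p} (f : Fin (suc p) → ℤ) where

    eliminate : (Fin (suc p) → ℤ) → Fin p → ℤ
    eliminate g j = f zero * g (suc j) - g zero * f (suc j)

    backSubstitute : (Fin p → ℤ) → Fin (suc p) → ℤ
    backSubstitute z zero    = - dot (f ∘ suc) z
    backSubstitute z (suc j) = f zero * z j

    dot-backSubstitute : ∀ g z → dot g (backSubstitute z) ≡ dot (eliminate g) z
    dot-backSubstitute g z = begin
      g zero * - dot (f ∘ suc) z + ∑[ j < p ] (g (suc j) * (f zero * z j))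
        ≡⟨ cong (λ e → g zero * - dot (f ∘ suc) z + e)
                (trans (sum-cong-≗ λ j → swap (g (suc j)) (f zero) (z j))
                       (sym (*-distribˡ-sum (f zero) (λ j → g (suc j) * z j)))) ⟩
      g zero * - dot (f ∘ suc) z + f zero * dot (g ∘ suc) z
        ≡⟨ collect (g zero) (dot (f ∘ suc) z) (f zero) (dot (g ∘ suc) z) ⟩
      f zero * dot (g ∘ suc) z + - g zero * dot (f ∘ suc) z
        ≡⟨ cong₂ _+_ (*-distribˡ-sum (f zero) (λ j → g (suc j) * z j))
                     (*-distribˡ-sum (- g zero) (λ j → f (suc j) * z j)) ⟩
      ∑[ j < p ] (f zero * (g (suc j) * z j)) + ∑[ j < p ] (- g zero * (f (suc j) * z j))
        ≡⟨ ∑-distrib-+ (λ j → f zero * (g (suc j) * z j)) (λ j → - g zero * (f (suc j) * z j)) ⟨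
      ∑[ j < p ] (f zero * (g (suc j) * z j) + - g zero * (f (suc j) * z j))
        ≡⟨ sum-cong-≗ (λ j → expand (f zero) (g zero) (g (suc j)) (f (suc j)) (z j)) ⟨
      dot (eliminate g) z ∎
      where
      open ≡-Reasoning
      swap : ∀ a b c → a * (b * c) ≡ b * (a * c)
      swap = solve-∀
      collect : ∀ a d b e → a * - d + b * e ≡ b * e + - a * d
      collect = solve-∀
      expand : ∀ a b c d z → (a * c - b * d) * z ≡ a * (c * z) + - b * (d * z)
      expand = solve-∀

    backSubstitute-solves-pivot : ∀ z → dot f (backSubstitute z) ≡ 0ℤ
    backSubstitute-solves-pivot z = begin
      dot f (backSubstitute z) ≡⟨ dot-backSubstitute f z ⟩
      dot (eliminate f) z      ≡⟨ ∑-zero (λ j → cong (_* z j) (ℤ.+-inverseʳ (f zero * f (suc j)))) ⟩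
      0ℤ                       ∎
      where open ≡-Reasoning

    backSubstitute-nontrivial : f zero ≢ 0ℤ → ∀ {z} → ¬ (∀ j → z j ≡ 0ℤ) →
                                ¬ (∀ j → backSubstitute z j ≡ 0ℤ)
    backSubstitute-nontrivial f₀≢0 z≢0 y≡0 =
      z≢0 λ j → [ flip contradiction f₀≢0 , id ]′ (ℤ.i*j≡0⇒i≡0∨j≡0 (f zero) (y≡0 (suc j)))

  dot-δ : ∀ {p} (g : Fin p → ℤ) i → dot g (δ i) ≡ g i
  dot-δ {p} g i = trans (sum-cong-≗ λ j → ℤ.*-comm (g j) (δ i j)) (∑-δ i g)

  nontrivial-solution : ∀ p (eqs : List (Fin p → ℤ)) → length eqs < p →
                        ∃[ y ] ¬ (∀ j → y j ≡ 0ℤ) × All (λ g → dot g y ≡ 0ℤ) eqs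
  nontrivial-solution zero    eqs ()
  nontrivial-solution (suc p) eqs |eqs|<1+p with all? (λ g → g zero ℤ.≟ 0ℤ) eqs
  ... | yes g₀≡0 = δ zero , (λ δ₀≡0 → contradiction (δ₀≡0 zero) λ ()) ,
                   All.map (λ {g} g₀≡0 → trans (dot-δ g zero) g₀≡0) g₀≡0
  ... | no ¬g₀≡0 =
    let z , z≢0 , z-solves = nontrivial-solution p (map eliminate rest) |rest|<p in
    backSubstitute z , backSubstitute-nontrivial (lookup-result pivot) z≢0 ,
    All.─⁻ pivot (backSubstitute-solves-pivot z)
                 (All.map (λ {g} → trans (dot-backSubstitute g z)) (All.map⁻ z-solves))
    where
    pivot : Any.Any (λ g → g zero ≢ 0ℤ) eqs
    pivot = All.¬All⇒Any¬ (λ g → g zero ℤ.≟ 0ℤ) eqs ¬g₀≡0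
    rest = eqs Any.─ pivot
    open Elimination (Any.lookup pivot)
    |rest|<p : length (map eliminate rest) < p
    |rest|<p = subst (_< p) (sym (length-map eliminate rest))
                     (ℕ.s<s⁻¹ (subst (_< suc p) (length-removeAt′ eqs (Any.index pivot)) |eqs|<1+p))

  square≡+ : ∀ i → i * i ≡ ℤ.+ (ℤ.∣ i ∣ ℕ.* ℤ.∣ i ∣)
  square≡+ (ℤ.+ 0)    = refl
  square≡+ ℤ.+[1+ _ ] = refl
  square≡+ ℤ.-[1+ _ ] = refl

  ∑-+-commute : ∀ {p} (g : Fin p → ℕ) → ∑[ j < p ] (ℤ.+ g j) ≡ ℤ.+ ℕΣ.sum g
  ∑-+-commute {zero}  g = refl
  ∑-+-commute {suc p} g = cong (ℤ.+ g zero +_) (∑-+-commute (g ∘ suc))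

  sum≡0⇒≡0 : ∀ {p} (g : Fin p → ℕ) → ℕΣ.sum g ≡ 0 → ∀ j → g j ≡ 0
  sum≡0⇒≡0 g ∑g≡0 zero    = ℕ.m+n≡0⇒m≡0 (g zero) ∑g≡0
  sum≡0⇒≡0 g ∑g≡0 (suc j) = sum≡0⇒≡0 (g ∘ suc) (ℕ.m+n≡0⇒n≡0 (g zero) ∑g≡0) j

  ∑-squares≡0⇒≡0 : ∀ {p} (y : Fin p → ℤ) → ∑[ j < p ] (y j * y j) ≡ 0ℤ → ∀ j → y j ≡ 0ℤ
  ∑-squares≡0⇒≡0 y ∑y²≡0 j = [ id , id ]′ (ℤ.i*j≡0⇒i≡0∨j≡0 (y j) yⱼ²≡0)
    where
    g : _ → ℕ
    g j = ℤ.∣ y j ∣ ℕ.* ℤ.∣ y j ∣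
    ∑g≡0 : ℕΣ.sum g ≡ 0
    ∑g≡0 = ℤ.+-injective (trans (sym (∑-+-commute g))
                                (trans (sym (sum-cong-≗ (square≡+ ∘ y))) ∑y²≡0))
    yⱼ²≡0 : y j * y j ≡ 0ℤ
    yⱼ²≡0 = trans (square≡+ (y j)) (cong ℤ.+_ (sum≡0⇒≡0 g ∑g≡0 j))

  module _ {p k} (a b : Fin k → Fin p → ℤ) where

    -- For 0/1 vectors aᵢ, bᵢ marking the sides of k bicliques, the number of
    -- bicliques containing the edge jj′.
    coverCount : Fin p → Fin p → ℤ
    coverCount j j′ = ∑[ i < k ] (a i j * b i j′ + a i j′ * b i j)

    quad-coverCount : ∀ y → (∀ i → dot (a i) y ≡ 0ℤ) → quad coverCount y ≡ 0ℤ
    quad-coverCount y a·y≡0 = begin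
      quad coverCount y
        ≡⟨ quad-∑ (λ i j j′ → a i j * b i j′ + a i j′ * b i j) y ⟩
      ∑[ i < k ] quad (λ j j′ → a i j * b i j′ + a i j′ * b i j) y
        ≡⟨ ∑-zero biclique-term ⟩
      0ℤ ∎
      where
      open ≡-Reasoning
      biclique-term : ∀ i → quad (λ j j′ → a i j * b i j′ + a i j′ * b i j) y ≡ 0ℤ
      biclique-term i = begin
        quad (λ j j′ → a i j * b i j′ + a i j′ * b i j) y
          ≡⟨ quad-+ (λ j j′ → a i j * b i j′) (λ j j′ → a i j′ * b i j) y ⟩
        quad (λ j j′ → a i j * b i j′) y + quad (λ j j′ → a i j′ * b i j) y
          ≡⟨ cong (quad (λ j j′ → a i j * b i j′) y +_)
                  (quad-cong (λ j j′ → ℤ.*-comm (a i j′) (b i j)) y) ⟩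
        quad (λ j j′ → a i j * b i j′) y + quad (λ j j′ → b i j * a i j′) y
          ≡⟨ cong₂ _+_ (quad-outer (a i) (b i) y) (quad-outer (b i) (a i) y) ⟩
        dot (a i) y * dot (b i) y + dot (b i) y * dot (a i) y
          ≡⟨ cong₂ _+_ (cong (_* dot (b i) y) (a·y≡0 i)) (cong (dot (b i) y *_) (a·y≡0 i)) ⟩
        0ℤ * dot (b i) y + dot (b i) y * 0ℤ
          ≡⟨ cong₂ _+_ (ℤ.*-zeroˡ (dot (b i) y)) (ℤ.*-zeroʳ (dot (b i) y)) ⟩
        0ℤ ∎

    graham-pollak-ℤ : (∀ j j′ → coverCount j j′ + δ j j′ ≡ 1ℤ) → p ≤ suc k
    graham-pollak-ℤ coverCount+δ≡1 with suc k ℕ.<? p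
    ... | no  1+k≮p = ℕ.≮⇒≥ 1+k≮p
    ... | yes 1+k<p = contradiction (∑-squares≡0⇒≡0 y ∑y²≡0) y≢0
      where
      solution = nontrivial-solution p ((λ _ → 1ℤ) ∷ tabulate a)
                   (subst (_< p) (cong suc (sym (length-tabulate a))) 1+k<p)
      y = proj₁ solution
      y≢0 = proj₁ (proj₂ solution)
      ∑y≡0 : dot (λ _ → 1ℤ) y ≡ 0ℤ
      ∑y≡0 = All.head (proj₂ (proj₂ solution))
      a·y≡0 : ∀ i → dot (a i) y ≡ 0ℤ
      a·y≡0 = All.tabulate⁻ (All.tail (proj₂ (proj₂ solution)))
      ∑y²≡0 : ∑[ j < p ] (y j * y j) ≡ 0ℤ
      ∑y²≡0 = begin
        ∑[ j < p ] (y j * y j)                     ≡⟨ quad-δ y ⟨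
        quad δ y                                   ≡⟨ ℤ.+-identityˡ (quad δ y) ⟨
        0ℤ + quad δ y                              ≡⟨ cong (_+ quad δ y) (quad-coverCount y a·y≡0) ⟨
        quad coverCount y + quad δ y               ≡⟨ quad-+ coverCount δ y ⟨
        quad (λ j j′ → coverCount j j′ + δ j j′) y ≡⟨ quad-cong coverCount+δ≡1 y ⟩
        quad (λ _ _ → 1ℤ * 1ℤ) y                   ≡⟨ quad-outer (λ _ → 1ℤ) (λ _ → 1ℤ) y ⟩
        dot (λ _ → 1ℤ) y * dot (λ _ → 1ℤ) y        ≡⟨ cong₂ _*_ ∑y≡0 ∑y≡0 ⟩
        0ℤ                                         ∎
        where open ≡-Reasoning

  𝟙 : ∀ {A : Set} → Dec A → ℤ
  𝟙 (yes _) = 1ℤ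
  𝟙 (no _)  = 0ℤ

  𝟙-yes : ∀ {A : Set} (A? : Dec A) → A → 𝟙 A? ≡ 1ℤ
  𝟙-yes (yes _) _ = refl
  𝟙-yes (no ¬a) a = contradiction a ¬a

  𝟙-no : ∀ {A : Set} (A? : Dec A) → ¬ A → 𝟙 A? ≡ 0ℤ
  𝟙-no (yes a) ¬a = contradiction a ¬a
  𝟙-no (no _)  _  = refl

  𝟙-× : ∀ {A B : Set} (A? : Dec A) (B? : Dec B) → 𝟙 A? * 𝟙 B? ≡ 𝟙 (A? ×-dec B?)
  𝟙-× (yes _) (yes _) = refl
  𝟙-× (yes _) (no _)  = refl
  𝟙-× (no _)  B?      = ℤ.*-zeroˡ (𝟙 B?)

  𝟙-⊎ : ∀ {A B : Set} (A? : Dec A) (B? : Dec B) → ¬ (A × B) → 𝟙 A? + 𝟙 B? ≡ 𝟙 (A? ⊎-dec B?)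
  𝟙-⊎ (yes a) (yes b) ¬a×b = contradiction (a , b) ¬a×b
  𝟙-⊎ (yes _) (no _)  _    = refl
  𝟙-⊎ (no _)  (yes _) _    = refl
  𝟙-⊎ (no _)  (no _)  _    = refl

  ∑-𝟙-unique : ∀ {k} {P : Fin k → Set} (P? : ∀ i → Dec (P i)) {i₀} → P i₀ → (∀ {i} → P i → i ≡ i₀) →
               ∑[ i < k ] 𝟙 (P? i) ≡ 1ℤ
  ∑-𝟙-unique {k} P? {i₀} Pi₀ unique = trans (sum-cong-≗ 𝟙≡δ) (∑-δ i₀ (λ _ → 1ℤ))
    where
    𝟙≡δ : ∀ i → 𝟙 (P? i) ≡ δ i₀ i * 1ℤ
    𝟙≡δ i with i₀ ≟ i
    ... | yes refl = trans (𝟙-yes (P? i) Pi₀) (cong (_* 1ℤ) (sym (δ-refl i)))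
    ... | no i₀≢i  = trans (𝟙-no (P? i) (i₀≢i ∘ sym ∘ unique)) (cong (_* 1ℤ) (sym (δ-≢ i₀≢i)))

  module _ {n} (B : Biclique n) where
    open Biclique B

    edgeOf? : ∀ u v → Dec (EdgeOf B u v)
    edgeOf? u v = (u ∈? left ×-dec v ∈? right) ⊎-dec (v ∈? left ×-dec u ∈? right)

    ¬EdgeOf-loop : ∀ {u} → ¬ EdgeOf B u u
    ¬EdgeOf-loop (inj₁ (u∈L , u∈R)) = disjoint u∈L u∈R
    ¬EdgeOf-loop (inj₂ (u∈L , u∈R)) = disjoint u∈L u∈R

    𝟙-EdgeOf : ∀ u v → 𝟙 (u ∈? left) * 𝟙 (v ∈? right) + 𝟙 (v ∈? left) * 𝟙 (u ∈? right)
                     ≡ 𝟙 (edgeOf? u v)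
    𝟙-EdgeOf u v = trans (cong₂ _+_ (𝟙-× (u ∈? left) (v ∈? right)) (𝟙-× (v ∈? left) (u ∈? right)))
                         (𝟙-⊎ (u ∈? left ×-dec v ∈? right) (v ∈? left ×-dec u ∈? right)
                              (λ ((u∈L , _) , (_ , u∈R)) → disjoint u∈L u∈R))

  graham-pollak : ∀ {n k p} {G : Graph n} → BicliquePartition G k →
                  (w : Fin p → Fin n) → (∀ {j j′} → j ≢ j′ → E G (w j) (w j′)) → p ≤ suc k
  graham-pollak {k = k} BP w w-clique = graham-pollak-ℤ a b coverCount+δ≡1
    where
    open BicliquePartition BP
    a b : Fin k → Fin _ → ℤ
    a i j = 𝟙 (w j ∈? Biclique.left (part i))
    b i j = 𝟙 (w j ∈? Biclique.right (part i))
    coverCount≡∑𝟙 : ∀ j j′ → coverCount a b j j′ ≡ ∑[ i < k ] 𝟙 (edgeOf? (part i) (w j) (w j′))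
    coverCount≡∑𝟙 j j′ = sum-cong-≗ λ i → 𝟙-EdgeOf (part i) (w j) (w j′)
    coverCount+δ≡1 : ∀ j j′ → coverCount a b j j′ + δ j j′ ≡ 1ℤ
    coverCount+δ≡1 j j′ with j ≟ j′
    ... | yes refl = cong₂ _+_ (trans (coverCount≡∑𝟙 j j) (∑-zero λ i → 𝟙-no _ (¬EdgeOf-loop (part i))))
                               (δ-refl j)
    ... | no j≢j′  = cong₂ _+_ (trans (coverCount≡∑𝟙 j j′) (∑-𝟙-unique _ in-i₀ λ {i} e → exactly uv i i₀ e in-i₀))
                               (δ-≢ j≢j′)
      where
      uv = w-clique j≢j′
      i₀ = proj₁ (covers uv)
      in-i₀ = proj₂ (covers uv)

lookup-injective : ∀ {A : Set} {xs : List A} → Unique xs → ∀ i j → lookup xs i ≡ lookup xs j → i ≡ j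
lookup-injective (_ ∷ _)     zero    zero    _  = refl
lookup-injective (x∉xs ∷ _)  zero    (suc j) eq = contradiction eq (All.lookup x∉xs (∈-lookup j))
lookup-injective (x∉xs ∷ _)  (suc i) zero    eq = contradiction (sym eq) (All.lookup x∉xs (∈-lookup i))
lookup-injective (_ ∷ !xs)   (suc i) (suc j) eq = cong suc (lookup-injective !xs i j eq)

module _ {A B : Set} (f : A → Maybe B) where

  ∈-mapMaybe⁻ : ∀ {b} xs → b ∈ₗ mapMaybe f xs → ∃[ x ] x ∈ₗ xs × f x ≡ just b
  ∈-mapMaybe⁻ (x ∷ xs) b∈ with f x in fx≡
  ∈-mapMaybe⁻ (x ∷ xs) (here refl) | just _ = x , here refl , fx≡
  ∈-mapMaybe⁻ (x ∷ xs) (there b∈)  | just _ with y , y∈ , fy≡ ← ∈-mapMaybe⁻ xs b∈ = y , there y∈ , fy≡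
  ∈-mapMaybe⁻ (x ∷ xs) b∈          | nothing with y , y∈ , fy≡ ← ∈-mapMaybe⁻ xs b∈ = y , there y∈ , fy≡

  InjectiveOn : List A → Set
  InjectiveOn xs = ∀ {x y} → x ∈ₗ xs → y ∈ₗ xs → f x ≡ f y → x ≡ y

  private
    InjectiveOn-tail : ∀ {x xs} → InjectiveOn (x ∷ xs) → InjectiveOn xs
    InjectiveOn-tail f-inj x∈ y∈ = f-inj (there x∈) (there y∈)

  mapMaybe-Unique : ∀ {xs} → InjectiveOn xs → Unique xs → Unique (mapMaybe f xs)
  mapMaybe-Unique {[]}     _     []           = []
  mapMaybe-Unique {x ∷ xs} f-inj (x∉xs ∷ !xs) with f x in fx≡
  ... | nothing = mapMaybe-Unique (InjectiveOn-tail f-inj) !xs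
  ... | just b  = All.tabulate b∉ ∷ mapMaybe-Unique (InjectiveOn-tail f-inj) !xs
    where
    b∉ : ∀ {b′} → b′ ∈ₗ mapMaybe f xs → b ≢ b′
    b∉ b′∈ refl with y , y∈ , fy≡ ← ∈-mapMaybe⁻ xs b′∈ =
      All.lookup x∉xs y∈ (f-inj (here refl) (there y∈) (trans fx≡ (sym fy≡)))

  length≤length-mapMaybe : ∀ xs → (∀ {x} → x ∈ₗ xs → f x ≢ nothing) →
                           length xs ≤ length (mapMaybe f xs)
  length≤length-mapMaybe []       _      = z≤n
  length≤length-mapMaybe (x ∷ xs) ≢nothing with f x in fx≡
  ... | just _  = s≤s (length≤length-mapMaybe xs (≢nothing ∘ there))
  ... | nothing = contradiction fx≡ (≢nothing (here refl))

  length≤1+length-mapMaybe : ∀ {xs} → InjectiveOn xs → Unique xs → length xs ≤ suc (length (mapMaybe f xs))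
  length≤1+length-mapMaybe {[]}     _     []           = z≤n
  length≤1+length-mapMaybe {x ∷ xs} f-inj (x∉xs ∷ !xs) with f x in fx≡
  ... | just _  = s≤s (length≤1+length-mapMaybe (InjectiveOn-tail f-inj) !xs)
  ... | nothing = s≤s (length≤length-mapMaybe xs λ y∈ fy≡ →
                    All.lookup x∉xs y∈ (f-inj (here refl) (there y∈) (trans fx≡ (sym fy≡))))

maximal-cliques-≡ : ∀ {n} {H : Graph n} {K K′} → IsMaximalClique H K → IsMaximalClique H K′ →
                    IsClique H (K ∪ K′) → K ≡ K′
maximal-cliques-≡ {K = K} {K′} (_ , K-maximal) (_ , K′-maximal) K∪K′-clique =
  ⊆-antisym (λ x∈K → K∪K′⊆K′ (p⊆p∪q K′ x∈K)) (λ x∈K′ → K∪K′⊆K (q⊆p∪q K K′ x∈K′))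
  where
  K∪K′⊆K  = K-maximal (K ∪ K′) (p⊆p∪q K′) K∪K′-clique
  K∪K′⊆K′ = K′-maximal (K ∪ K′) (q⊆p∪q K K′) K∪K′-clique

module SplitGraph {n} (G : Graph n) (C : Subset n)
                  (C-clique : IsClique G C) (∁C-independent : IsIndependent G (∁ C)) where

  Gᶜ = complement G

  -- The vertex of C in a clique of Gᶜ, if there is one (there is at most one).
  meet : Subset n → Maybe (Fin n)
  meet K with Fin.any? (λ v → v ∈? K ×-dec v ∈? C)
  ... | yes (v , _) = just v
  ... | no _        = nothing

  meet-∈C : ∀ K {c} → meet K ≡ just c → c ∈ C
  meet-∈C K meet≡ with Fin.any? (λ v → v ∈? K ×-dec v ∈? C)
  meet-∈C K refl | yes (_ , _ , c∈C) = c∈C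

  -- Compatible m w: w may lie in a clique of Gᶜ whose vertex in C is m.
  Compatible : Maybe (Fin n) → Fin n → Set
  Compatible (just c) w = w ≡ c ⊎ (w ∈ ∁ C × ¬ E G w c)
  Compatible nothing  w = w ∈ ∁ C

  meet-compatible : ∀ {K} → IsClique Gᶜ K → ∀ {w} → w ∈ K → Compatible (meet K) w
  meet-compatible {K} K-clique {w} w∈K with Fin.any? (λ v → v ∈? K ×-dec v ∈? C)
  ... | no ¬meets = x∉p⇒x∈∁p λ w∈C → ¬meets (w , w∈K , w∈C)
  ... | yes (c , c∈K , c∈C) with w ≟ c
  ...   | yes w≡c = inj₁ w≡c
  ...   | no  w≢c = inj₂ (x∉p⇒x∈∁p (¬wc ∘ C-clique′) , ¬wc)
    where
    ¬wc = proj₂ (K-clique w∈K c∈K w≢c)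
    C-clique′ = λ w∈C → C-clique w∈C c∈C w≢c

  compatible-clique : ∀ m {U} → (∀ {w} → w ∈ U → Compatible m w) → IsClique Gᶜ U
  compatible-clique m compatible {u} {v} u∈U v∈U u≢v =
    u≢v , non-adjacent m (compatible u∈U) (compatible v∈U)
    where
    non-adjacent : ∀ m → Compatible m u → Compatible m v → ¬ E G u v
    non-adjacent nothing  u∈I              v∈I              = ∁C-independent u∈I v∈I
    non-adjacent (just c) (inj₁ refl)      (inj₁ refl)      = contradiction refl u≢v
    non-adjacent (just c) (inj₁ refl)      (inj₂ (_ , ¬vc)) = ¬vc ∘ E-sym G
    non-adjacent (just c) (inj₂ (_ , ¬uc)) (inj₁ refl)      = ¬uc
    non-adjacent (just c) (inj₂ (u∈I , _)) (inj₂ (v∈I , _)) = ∁C-independent u∈I v∈I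

  module _ (L : MaxCliqueEnum Gᶜ) where
    open MaxCliqueEnum L

    meet-injective : InjectiveOn meet cliques
    meet-injective {K} {K′} K∈ K′∈ meetK≡meetK′ =
      maximal-cliques-≡ {H = Gᶜ} K-maximal K′-maximal (compatible-clique (meet K) compatible)
      where
      K-maximal  = proj₁ (complete K) K∈
      K′-maximal = proj₁ (complete K′) K′∈
      compatible : ∀ {w} → w ∈ K ∪ K′ → Compatible (meet K) w
      compatible w∈ with x∈p∪q⁻ K K′ w∈
      ... | inj₁ w∈K  = meet-compatible {K} (proj₁ K-maximal) w∈K
      ... | inj₂ w∈K′ = subst (λ m → Compatible m _) (sym meetK≡meetK′)
                              (meet-compatible {K′} (proj₁ K′-maximal) w∈K′)

    centres : List (Fin n)
    centres = mapMaybe meet cliques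

    mc≤1+|centres| : mc L ≤ suc (length centres)
    mc≤1+|centres| = length≤1+length-mapMaybe meet meet-injective unique

    centres-clique : ∀ {j j′} → j ≢ j′ → E G (lookup centres j) (lookup centres j′)
    centres-clique {j} {j′} j≢j′ =
      C-clique (centre∈C j) (centre∈C j′) (j≢j′ ∘ lookup-injective centres-unique j j′)
      where
      centres-unique = mapMaybe-Unique meet meet-injective unique
      centre∈C : ∀ j → lookup centres j ∈ C
      centre∈C j with K , _ , meetK≡ ← ∈-mapMaybe⁻ meet cliques (∈-lookup j) = meet-∈C K meetK≡

open GrahamPollak using (graham-pollak)
open import Data.Nat using (_+_)

theorem7 : ∀ {n} (G : Graph n) → IsSplit G →
           (L : MaxCliqueEnum (complement G)) →
           ∀ k → BicliquePartition G k → mc L ≤ k + 2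
theorem7 G (C , C-clique , ∁C-independent) L k BP = begin
  mc L                     ≤⟨ mc≤1+|centres| L ⟩
  suc (length (centres L)) ≤⟨ s≤s (graham-pollak BP (lookup (centres L)) (centres-clique L)) ⟩
  suc (suc k)              ≡⟨ ℕ.+-comm 2 k ⟩
  k + 2                    ∎
  where
  open SplitGraph G C C-clique ∁C-independent
  open ℕ.≤-Reasoning
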